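{- $B(P_4 \square P_4) = 5$.
   Context: $P_4$ is the path on $4$ vertices. The Cartesian product $G\square H$ has vertex set $V(G)\times V(H)$, with $(u,v)$ adjacent to $(x,y)$ iff either $ux\in E(G)$ and $v=y$, or $u=x$ and $vy\in E(H)$. Bodyguards and Presidents is a two-player game on a finite simple graph $G$. One player controls a set of tokens called bodyguards, the other a single token called the president. First all bodyguards are placed on vertices (several may share a vertex), then the president is placed. The players then alternate turns, bodyguards first; on a player's turn, each token they control either moves to an adjacent vertex or stays put. The president is surrounded if every vertex of the open neighbourhood of the president's vertex is occupied by a bodyguard. The bodyguards win if there is a finite time after which, at the end of every bodyguard turn, the president is surrounded; otherwise the president wins. The bodyguard number $B(G)$ is the minimum number of bodyguards that guarantees a win for the bodyguards on $G$. -}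

module Defs where

open import Data.Nat using (ℕ; zero; suc; _≤_; _<_)
open import Data.Fin using (Fin; toℕ)
open import Data.Product using (_×_; _,_; ∃; ∃-syntax)
open import Data.Sum using (_⊎_)
open import Data.List using (List; map; upTo)
open import Relation.Binary.PropositionalEquality using (_≡_)
open import Relation.Nullary using (¬_)

record Graph : Set₁ where
  field
    V   : Set
    Adj : V → V → Set
open Graph public

Path : ℕ → Graph
Path n = record
  { V   = Fin n
  ; Adj = λ i j → (suc (toℕ i) ≡ toℕ j) ⊎ (suc (toℕ j) ≡ toℕ i)
  }

_□_ : Graph → Graph → Graph
G □ H = record
  { V   = V G × V H
  ; Adj = λ { (u , v) (x , y) → (Adj G u x × v ≡ y) ⊎ (u ≡ x × Adj H v y) }
  }

module Game (G : Graph) where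

  -- positions of k bodyguards (several may share a vertex)
  Conf : ℕ → Set
  Conf k = Fin k → V G

  Step : V G → V G → Set
  Step u w = u ≡ w ⊎ Adj G u w

  Surrounded : {k : ℕ} → Conf k → V G → Set
  Surrounded {k} b p = ∀ w → Adj G p w → ∃[ i ] b i ≡ w

  -- A (deterministic, full-information) bodyguard strategy: an initial
  -- placement, and a move rule depending on the whole history
  -- [(b₀ , p₀) , … , (bₜ , pₜ)] of positions so far.
  record Strategy (k : ℕ) : Set where
    field
      place : Conf k
      move  : List (Conf k × V G) → Conf k
  open Strategy public

  history : {k : ℕ} → (ℕ → Conf k) → (ℕ → V G) → ℕ → List (Conf k × V G)
  history b p t = map (λ i → b i , p i) (upTo (suc t))

  -- (b , p) is a play in which the bodyguards follow σ and the president
  -- moves legally: b 0 placed first, then p 0 placed; in round t the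
  -- bodyguards move to b (suc t), then the president moves to p (suc t).
  Consistent : {k : ℕ} → Strategy k → (ℕ → Conf k) → (ℕ → V G) → Set
  Consistent σ b p =
    (b 0 ≡ place σ) ×
    (∀ t → b (suc t) ≡ move σ (history b p t)) ×
    (∀ t → Step (p t) (p (suc t)))

  -- σ is winning: along every consistent play, all bodyguard moves are legal,
  -- and from some time on, at the end of every bodyguard turn
  -- (positions b (suc n), president still at p n) the president is surrounded.
  Winning : {k : ℕ} → Strategy k → Set
  Winning σ = ∀ b p → Consistent σ b p →
    (∀ t i → Step (b t i) (b (suc t) i)) ×
    (∃[ N ] ∀ n → N ≤ n → Surrounded (b (suc n)) (p n))

  BodyguardsWin : ℕ → Set
  BodyguardsWin k = ∃[ σ ] Winning {k} σ

  BodyguardNumberIs : ℕ → Set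
  BodyguardNumberIs m = BodyguardsWin m × (∀ k → k < m → ¬ BodyguardsWin k)

open Game public using (BodyguardNumberIs)

-- Fewer than five bodyguards: the president stays in the inner 2×2 square, always on a vertex q
-- that the bodyguards do not threaten, i.e. whose four neighbours cannot be matched to four
-- distinct bodyguards each within one step of its neighbour; then the next bodyguard move
-- cannot surround q. If after that move q and both its inner neighbours are threatened, the
-- bodyguards matched to four mutually distant vertices around q are all the bodyguards, and
-- comparing the three matchings pins them onto the neighbours of q, so q was already
-- surrounded. Hence the president can always stay or step to an unthreatened inner vertex.
-- Initially some inner vertex is unthreatened: otherwise the two diagonal inner vertices (1,1)
-- and (2,2) would both be surrounded, which takes five bodyguards.
--
-- Five bodyguards: after the president's placement p₀ and first move p₁ they reach, up to a
-- relabelling depending on p₀ and p₁, a formation that surrounds the president and follows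
-- each of his steps with single steps of its own.
module Submission where

open import Defs
open import Data.Empty using (⊥; ⊥-elim)
open import Data.Fin as Fin using (Fin; toℕ; opposite)
open import Data.Fin.Patterns using (0F; 1F; 2F; 3F; 4F)
open import Data.Fin.Properties using (all?; any?; injective⇒≤)
open import Data.List using (List; []; _∷_; _∷ʳ_; map; applyUpTo; upTo)
open import Data.List.Properties using (map-upTo; upTo-∷ʳ; map-++)
open import Data.Nat as ℕ using (ℕ; zero; suc; _≤_; _<_; s≤s⁻¹)
open import Data.Nat.Properties using (≤⇒≯; ≤-refl)
open import Data.Product using (Σ; Σ-syntax; ∃; ∃-syntax; _×_; _,_; proj₁; proj₂)
open import Data.Product.Properties using (≡-dec)
open import Data.Sum using (inj₁; inj₂)
open import Data.Vec using (Vec; []; _∷_; lookup; tabulate)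
open import Data.Vec.Properties using (tabulate∘lookup)
open import Data.Vec.Membership.Propositional using (_∈_)
import Data.Vec.Membership.DecPropositional as DecMembership
open import Data.Vec.Relation.Binary.Pointwise.Inductive as Pointwise using (Pointwise; []; _∷_)
open import Data.Vec.Relation.Unary.All as All using (All; []; _∷_)
open import Data.Vec.Relation.Unary.All.Properties using (lookup⁺)
open import Data.Vec.Relation.Unary.AllPairs using (allPairs?; []; _∷_)
open import Data.Vec.Relation.Unary.Unique.Propositional using (Unique)
open import Data.Vec.Relation.Unary.Unique.Propositional.Properties as Unique using (lookup-injective)
open import Function using (id; _∘_)
open import Relation.Binary.Definitions using (DecidableEquality)
open import Relation.Binary.PropositionalEquality
open import Relation.Nullary using (Dec; yes; no; ¬_; ¬?)
open import Relation.Nullary.Decidable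
  using (True; toWitness; from-yes; map′; decidable-stable; _×-dec_; _⊎-dec_; _→-dec_)

unique⇒≤ : ∀ {k n} {gs : Vec (Fin k) n} → Unique gs → n ≤ k
unique⇒≤ u = injective⇒≤ (λ {i} {j} → lookup-injective u i j)

unique-exhaustive : ∀ {k n x y} {gs : Vec (Fin k) n} → k ≤ n → Unique gs → (x ≢ y → All (x ≢_) gs) → x ≡ y
unique-exhaustive k≤n u others = decidable-stable (_ Fin.≟ _) λ x≢y → ≤⇒≯ k≤n (unique⇒≤ (others x≢y ∷ u))

any-vec? : ∀ {k n} {P : Vec (Fin k) n → Set} → (∀ gs → Dec (P gs)) → Dec (∃ P)
any-vec? {n = zero}  P? = map′ ([] ,_) (λ { ([] , p) → p }) (P? [])
any-vec? {n = suc n} P? =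
  map′ (λ (g , gs , p) → g ∷ gs , p) (λ { (g ∷ gs , p) → g , gs , p })
       (any? λ g → any-vec? λ gs → P? (g ∷ gs))

all-×? : ∀ {m n} {P : Fin m × Fin n → Set} → (∀ x → Dec (P x)) → Dec (∀ x → P x)
all-×? P? = map′ (λ h (i , j) → h i j) (λ h i j → h (i , j)) (all? λ i → all? λ j → P? (i , j))

by-exhaustion : ∀ {m n} {P : Fin m × Fin n → Set} (P? : ∀ x → Dec (P x)) →
                {True (all-×? P?)} → ∀ x → P x
by-exhaustion P? {checked} = toWitness checked

final : ∀ {A : Set} → A → List A → A
final x []       = x
final _ (x ∷ xs) = final x xs

final-applyUpTo : ∀ {A : Set} (f : ℕ → A) n x → final x (applyUpTo f (suc n)) ≡ f n
final-applyUpTo f zero    x = refl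
final-applyUpTo f (suc n) x = final-applyUpTo (f ∘ suc) n (f 0)

path-adj? : ∀ {n} (i j : Fin n) → Dec (Adj (Path n) i j)
path-adj? i j = (suc (toℕ i) ℕ.≟ toℕ j) ⊎-dec (suc (toℕ j) ℕ.≟ toℕ i)

□-adj? : ∀ {G H} → DecidableEquality (V G) → DecidableEquality (V H) →
         (∀ u w → Dec (Adj G u w)) → (∀ u w → Dec (Adj H u w)) → ∀ u w → Dec (Adj (G □ H) u w)
□-adj? _≟G_ _≟H_ adjG? adjH? (u , v) (x , y) =
  (adjG? u x ×-dec (v ≟H y)) ⊎-dec ((u ≟G x) ×-dec adjH? v y)

module GameProperties (G : Graph) where
  open Game G

  Moves : ∀ {k} → Conf k → Conf k → Set
  Moves C C′ = ∀ i → Step (C i) (C′ i)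

  Occupied : ∀ {k} → Conf k → V G → Set
  Occupied C w = ∃[ i ] C i ≡ w

  Threatens : ∀ {k n} → Conf k → Vec (V G) n → Set
  Threatens {k} {n} C ws = Σ[ gs ∈ Vec (Fin k) n ] Unique gs × Pointwise (λ g w → Step (C g) w) gs ws

  threatens? : (∀ u w → Dec (Step u w)) → ∀ {k n} (C : Conf k) (ws : Vec (V G) n) → Dec (Threatens C ws)
  threatens? step? C ws =
    any-vec? λ gs → allPairs? (λ g h → ¬? (g Fin.≟ h)) gs ×-dec Pointwise.decidable (step? ∘ C) gs ws

  distinct-occupants : ∀ {k n} {C : Conf k} {ws : Vec (V G) n} → Unique ws → All (Occupied C) ws →
                       Σ[ gs ∈ Vec (Fin k) n ] Unique gs × Pointwise (λ g w → C g ≡ w) gs ws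
  distinct-occupants {k} {n} {C} {ws} u occupied =
    tabulate occupant ,
    Unique.tabulate⁺ occupant-injective ,
    subst (Pointwise _ _) (tabulate∘lookup ws) (Pointwise.tabulate⁺ (proj₂ ∘ lookup⁺ occupied))
    where
    occupant : Fin n → Fin k
    occupant = proj₁ ∘ lookup⁺ occupied

    occupant-injective : ∀ {s t} → occupant s ≡ occupant t → s ≡ t
    occupant-injective {s} {t} e = lookup-injective u s t
      (trans (sym (proj₂ (lookup⁺ occupied s))) (trans (cong C e) (proj₂ (lookup⁺ occupied t))))

  occupied-unique⇒≤ : ∀ {k n} {C : Conf k} {ws : Vec (V G) n} →
                      Unique ws → All (Occupied C) ws → n ≤ k
  occupied-unique⇒≤ u occupied = unique⇒≤ (proj₁ (proj₂ (distinct-occupants u occupied)))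

  surrounded⇒threatened : ∀ {k n v} {C C′ : Conf k} {ws : Vec (V G) n} →
                          Moves C C′ → Surrounded C′ v → Unique ws → All (Adj G v) ws → Threatens C ws
  surrounded⇒threatened {C = C} moves surrounded u adjacent
    with gs , unique-gs , occupy ← distinct-occupants u (All.map (surrounded _) adjacent) =
    gs , unique-gs , Pointwise.map (λ {g} e → subst (Step (C g)) e (moves g)) occupy

  Far : V G → V G → Set
  Far x y = ∀ u → Step u x → Step u y → ⊥

  apart : ∀ {k x y} {C : Conf k} {g h : Fin k} → Far x y → Step (C g) x → Step (C h) y → g ≢ h
  apart far s t refl = far _ s t

  history-∷ʳ : ∀ {k} (b : ℕ → Conf k) (p : ℕ → V G) t →
               history b p (suc t) ≡ history b p t ∷ʳ (b (suc t) , p (suc t))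
  history-∷ʳ b p t = trans (cong (map _) (sym (upTo-∷ʳ (suc t)))) (map-++ _ (upTo (suc t)) _)

  final-history : ∀ {k} (b : ℕ → Conf k) (p : ℕ → V G) t x → final x (history b p t) ≡ (b t , p t)
  final-history b p t x = trans (cong (final x) (map-upTo _ (suc t))) (final-applyUpTo (λ i → b i , p i) t x)

  record Formation (k : ℕ) : Set where
    field
      at        : V G → Conf k
      follows   : ∀ {u w} → Step u w → Moves (at u) (at w)
      surrounds : ∀ v → Surrounded (at v) v
  open Formation

  relabel : ∀ {k} → Formation k → (ρ : Fin k → Fin k) → (∀ j → ∃[ i ] ρ i ≡ j) → Formation k
  relabel F ρ onto = record
    { at        = λ v → at F v ∘ ρ
    ; follows   = λ s → follows F s ∘ ρ
    ; surrounds = λ v w a → let j , occupied = surrounds F v w a ; i , ρi≡j = onto j in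
                            i , trans (cong (at F v) ρi≡j) occupied
    }

  opening-into-formation-wins :
    ∀ {k} (C₀ : Conf k) (C₁ : V G → Conf k) (Φ : V G → V G → Formation k) →
    (∀ p₀ → Moves C₀ (C₁ p₀)) →
    (∀ {p₀ p₁} → Step p₀ p₁ → Moves (C₁ p₀) (at (Φ p₀ p₁) p₁)) →
    BodyguardsWin k
  opening-into-formation-wins {k} C₀ C₁ Φ opening₀ opening₁ = σ , winning
    where
    σ : Strategy k
    σ = record { place = C₀ ; move = respond }
      where
      respond : List (Conf k × V G) → Conf k
      respond []                   = C₀    -- never used: histories are non-empty
      respond ((_ , p₀) ∷ [])      = C₁ p₀
      respond ((_ , p₀) ∷ x₁ ∷ xs) = at (Φ p₀ (proj₂ x₁)) (proj₂ (final x₁ xs))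

    winning : Winning σ
    winning b p (b₀ , b-moves , p-steps) = legal , 1 , λ { (suc n) _ → surrounded n }
      where
      F : Formation k
      F = Φ (p 0) (p 1)

      settled : ∀ t → b (suc (suc t)) ≡ at F (p (suc t))
      settled t = trans (b-moves (suc t)) (cong (at F ∘ proj₂) (final-history b p (suc t) (b 0 , p 0)))

      legal : ∀ t → Moves (b t) (b (suc t))
      legal 0             = subst₂ Moves (sym b₀) (sym (b-moves 0)) (opening₀ (p 0))
      legal 1             = subst₂ Moves (sym (b-moves 0)) (sym (settled 0)) (opening₁ (p-steps 0))
      legal (suc (suc t)) =
        subst₂ Moves (sym (settled t)) (sym (settled (suc t))) (follows F (p-steps (suc t)))

      surrounded : ∀ n → Surrounded (b (suc (suc n))) (p (suc n))
      surrounded n = subst (λ C → Surrounded C (p (suc n))) (sym (settled n)) (surrounds F (p (suc n)))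

  module _ {k : ℕ} {Spot : Set} (pos : Spot → V G) (Safe : Conf k → Spot → Set)
           (start : ∀ C → Σ Spot (Safe C))
           (respond : ∀ C q → Σ[ q′ ∈ Spot ] Step (pos q) (pos q′) ×
                                             (¬ Surrounded C (pos q) → Safe C q′))
           (unsurrounded : ∀ {C C′ q} → Safe C q → Moves C C′ → ¬ Surrounded C′ (pos q))
           where

    president-escapes : ¬ BodyguardsWin k
    president-escapes (σ , winning) =
      let legal , N , surrounded = winning b p consistent in
      unsurrounded (safe legal N) (legal N) (surrounded N ≤-refl)
      where
      mutual
        b : ℕ → Conf k
        b zero    = place σ
        b (suc t) = move σ (played t)

        spot : ℕ → Spot
        spot zero    = proj₁ (start (place σ))
        spot (suc t) = proj₁ (respond (b (suc t)) (spot t))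

        played : ℕ → List (Conf k × V G)
        played zero    = (b 0 , pos (spot 0)) ∷ []
        played (suc t) = played t ∷ʳ (b (suc t) , pos (spot (suc t)))

      p : ℕ → V G
      p = pos ∘ spot

      history≡played : ∀ t → history b p t ≡ played t
      history≡played zero    = refl
      history≡played (suc t) =
        trans (history-∷ʳ b p t) (cong (_∷ʳ (b (suc t) , p (suc t))) (history≡played t))

      consistent : Consistent σ b p
      consistent =
        refl , (λ t → cong (move σ) (sym (history≡played t))) , (λ t → proj₁ (proj₂ (respond _ (spot t))))

      safe : (∀ t → Moves (b t) (b (suc t))) → ∀ t → Safe (b t) (spot t)
      safe legal zero    = proj₂ (start (place σ))
      safe legal (suc t) = proj₂ (proj₂ (respond _ (spot t))) (unsurrounded (safe legal t) (legal t))

Grid : Graph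
Grid = Path 4 □ Path 4

open Game Grid hiding (BodyguardNumberIs)
open GameProperties Grid

Vertex : Set
Vertex = V Grid

_≟ᵥ_ : DecidableEquality Vertex
_≟ᵥ_ = ≡-dec Fin._≟_ Fin._≟_

open DecMembership _≟ᵥ_ using (_∈?_)

adj? : ∀ u w → Dec (Adj Grid u w)
adj? = □-adj? Fin._≟_ Fin._≟_ path-adj? path-adj?

step? : ∀ u w → Dec (Step u w)
step? u w = (u ≟ᵥ w) ⊎-dec adj? u w

unique? : ∀ {n} (ws : Vec Vertex n) → Dec (Unique ws)
unique? = allPairs? (λ u w → ¬? (u ≟ᵥ w))

initial : Conf 5
initial = lookup ((0F , 2F) ∷ (1F , 0F) ∷ (1F , 3F) ∷ (2F , 0F) ∷ (3F , 2F) ∷ [])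

reply : Vertex → Conf 5
reply (0F , 0F) = lookup ((1F , 2F) ∷ (0F , 0F) ∷ (1F , 3F) ∷ (1F , 0F) ∷ (2F , 2F) ∷ [])
reply (0F , 1F) = lookup ((0F , 2F) ∷ (1F , 0F) ∷ (1F , 3F) ∷ (2F , 1F) ∷ (2F , 2F) ∷ [])
reply (0F , 2F) = lookup ((0F , 2F) ∷ (1F , 0F) ∷ (1F , 3F) ∷ (2F , 1F) ∷ (2F , 2F) ∷ [])
reply (0F , 3F) = lookup ((0F , 2F) ∷ (1F , 0F) ∷ (1F , 3F) ∷ (2F , 1F) ∷ (2F , 2F) ∷ [])
reply (1F , 0F) = lookup ((1F , 2F) ∷ (0F , 0F) ∷ (1F , 3F) ∷ (2F , 0F) ∷ (2F , 2F) ∷ [])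
reply (1F , 1F) = lookup ((0F , 1F) ∷ (1F , 0F) ∷ (1F , 3F) ∷ (2F , 1F) ∷ (2F , 2F) ∷ [])
reply (1F , 2F) = lookup ((0F , 2F) ∷ (1F , 0F) ∷ (1F , 3F) ∷ (2F , 1F) ∷ (2F , 2F) ∷ [])
reply (1F , 3F) = lookup ((0F , 3F) ∷ (1F , 0F) ∷ (2F , 3F) ∷ (2F , 0F) ∷ (2F , 2F) ∷ [])
reply (2F , 0F) = lookup ((1F , 2F) ∷ (1F , 0F) ∷ (1F , 3F) ∷ (3F , 0F) ∷ (2F , 2F) ∷ [])
reply (2F , 1F) = lookup ((1F , 2F) ∷ (1F , 1F) ∷ (1F , 3F) ∷ (2F , 0F) ∷ (3F , 1F) ∷ [])
reply (2F , 2F) = lookup ((1F , 2F) ∷ (1F , 0F) ∷ (1F , 3F) ∷ (2F , 1F) ∷ (3F , 2F) ∷ [])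
reply (2F , 3F) = lookup ((1F , 2F) ∷ (1F , 0F) ∷ (1F , 3F) ∷ (2F , 0F) ∷ (3F , 3F) ∷ [])
reply (3F , 0F) = lookup ((0F , 2F) ∷ (2F , 0F) ∷ (2F , 3F) ∷ (2F , 0F) ∷ (3F , 1F) ∷ [])
reply (3F , 1F) = lookup ((1F , 2F) ∷ (2F , 0F) ∷ (1F , 3F) ∷ (3F , 0F) ∷ (3F , 2F) ∷ [])
reply (3F , 2F) = lookup ((1F , 2F) ∷ (2F , 0F) ∷ (1F , 3F) ∷ (2F , 1F) ∷ (3F , 2F) ∷ [])
reply (3F , 3F) = lookup ((1F , 2F) ∷ (1F , 0F) ∷ (1F , 3F) ∷ (2F , 1F) ∷ (3F , 2F) ∷ [])

shadow : Vertex → Conf 5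
shadow (0F , 0F) = lookup ((2F , 3F) ∷ (1F , 0F) ∷ (0F , 1F) ∷ (1F , 2F) ∷ (2F , 1F) ∷ [])
shadow (0F , 1F) = lookup ((1F , 3F) ∷ (0F , 0F) ∷ (1F , 1F) ∷ (0F , 2F) ∷ (2F , 1F) ∷ [])
shadow (0F , 2F) = lookup ((0F , 3F) ∷ (0F , 0F) ∷ (0F , 1F) ∷ (1F , 2F) ∷ (2F , 2F) ∷ [])
shadow (0F , 3F) = lookup ((1F , 3F) ∷ (1F , 0F) ∷ (1F , 1F) ∷ (0F , 2F) ∷ (2F , 2F) ∷ [])
shadow (1F , 0F) = lookup ((1F , 3F) ∷ (0F , 0F) ∷ (1F , 1F) ∷ (1F , 2F) ∷ (2F , 0F) ∷ [])
shadow (1F , 1F) = lookup ((1F , 3F) ∷ (1F , 0F) ∷ (0F , 1F) ∷ (1F , 2F) ∷ (2F , 1F) ∷ [])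
shadow (1F , 2F) = lookup ((1F , 3F) ∷ (1F , 0F) ∷ (1F , 1F) ∷ (0F , 2F) ∷ (2F , 2F) ∷ [])
shadow (1F , 3F) = lookup ((0F , 3F) ∷ (1F , 0F) ∷ (2F , 1F) ∷ (1F , 2F) ∷ (2F , 3F) ∷ [])
shadow (2F , 0F) = lookup ((1F , 3F) ∷ (1F , 0F) ∷ (2F , 1F) ∷ (1F , 2F) ∷ (3F , 0F) ∷ [])
shadow (2F , 1F) = lookup ((1F , 3F) ∷ (2F , 0F) ∷ (1F , 1F) ∷ (2F , 2F) ∷ (3F , 1F) ∷ [])
shadow (2F , 2F) = lookup ((2F , 3F) ∷ (1F , 0F) ∷ (2F , 1F) ∷ (1F , 2F) ∷ (3F , 2F) ∷ [])
shadow (2F , 3F) = lookup ((1F , 3F) ∷ (1F , 0F) ∷ (1F , 1F) ∷ (2F , 2F) ∷ (3F , 3F) ∷ [])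
shadow (3F , 0F) = lookup ((1F , 3F) ∷ (2F , 0F) ∷ (2F , 1F) ∷ (1F , 2F) ∷ (3F , 1F) ∷ [])
shadow (3F , 1F) = lookup ((0F , 3F) ∷ (3F , 0F) ∷ (2F , 1F) ∷ (2F , 2F) ∷ (3F , 2F) ∷ [])
shadow (3F , 2F) = lookup ((1F , 3F) ∷ (2F , 0F) ∷ (3F , 1F) ∷ (2F , 2F) ∷ (3F , 3F) ∷ [])
shadow (3F , 3F) = lookup ((2F , 3F) ∷ (1F , 0F) ∷ (2F , 1F) ∷ (2F , 2F) ∷ (3F , 2F) ∷ [])

roles : Vertex → Vertex → Fin 5 → Fin 5
roles (0F , 0F) (0F , 0F) = lookup (3F ∷ 2F ∷ 0F ∷ 1F ∷ 4F ∷ [])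
roles (0F , 0F) (1F , 0F) = lookup (2F ∷ 1F ∷ 0F ∷ 4F ∷ 3F ∷ [])
roles (0F , 0F) (0F , 1F) = lookup (3F ∷ 1F ∷ 0F ∷ 2F ∷ 4F ∷ [])
roles (0F , 1F) (0F , 1F) = lookup (3F ∷ 1F ∷ 0F ∷ 2F ∷ 4F ∷ [])
roles (0F , 1F) (1F , 1F) = lookup (2F ∷ 1F ∷ 0F ∷ 4F ∷ 3F ∷ [])
roles (0F , 1F) (0F , 0F) = lookup (2F ∷ 1F ∷ 0F ∷ 4F ∷ 3F ∷ [])
roles (0F , 1F) (0F , 2F) = lookup (2F ∷ 1F ∷ 0F ∷ 4F ∷ 3F ∷ [])
roles (0F , 2F) (0F , 2F) = lookup (2F ∷ 1F ∷ 0F ∷ 4F ∷ 3F ∷ [])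
roles (0F , 2F) (1F , 2F) = lookup (3F ∷ 1F ∷ 0F ∷ 2F ∷ 4F ∷ [])
roles (0F , 2F) (0F , 1F) = lookup (3F ∷ 1F ∷ 0F ∷ 2F ∷ 4F ∷ [])
roles (0F , 2F) (0F , 3F) = lookup (3F ∷ 1F ∷ 0F ∷ 2F ∷ 4F ∷ [])
roles (0F , 3F) (0F , 3F) = lookup (3F ∷ 1F ∷ 0F ∷ 2F ∷ 4F ∷ [])
roles (0F , 3F) (1F , 3F) = lookup (0F ∷ 1F ∷ 3F ∷ 2F ∷ 4F ∷ [])
roles (0F , 3F) (0F , 2F) = lookup (2F ∷ 1F ∷ 0F ∷ 4F ∷ 3F ∷ [])
roles (1F , 0F) (1F , 0F) = lookup (2F ∷ 1F ∷ 0F ∷ 4F ∷ 3F ∷ [])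
roles (1F , 0F) (0F , 0F) = lookup (3F ∷ 2F ∷ 0F ∷ 1F ∷ 4F ∷ [])
roles (1F , 0F) (2F , 0F) = lookup (0F ∷ 1F ∷ 3F ∷ 4F ∷ 2F ∷ [])
roles (1F , 0F) (1F , 1F) = lookup (0F ∷ 2F ∷ 3F ∷ 1F ∷ 4F ∷ [])
roles (1F , 1F) (1F , 1F) = lookup (2F ∷ 1F ∷ 0F ∷ 4F ∷ 3F ∷ [])
roles (1F , 1F) (0F , 1F) = lookup (3F ∷ 1F ∷ 0F ∷ 2F ∷ 4F ∷ [])
roles (1F , 1F) (2F , 1F) = lookup (2F ∷ 1F ∷ 0F ∷ 4F ∷ 3F ∷ [])
roles (1F , 1F) (1F , 0F) = lookup (1F ∷ 2F ∷ 0F ∷ 4F ∷ 3F ∷ [])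
roles (1F , 1F) (1F , 2F) = lookup (3F ∷ 1F ∷ 0F ∷ 2F ∷ 4F ∷ [])
roles (1F , 2F) (1F , 2F) = lookup (3F ∷ 1F ∷ 0F ∷ 2F ∷ 4F ∷ [])
roles (1F , 2F) (0F , 2F) = lookup (2F ∷ 1F ∷ 0F ∷ 4F ∷ 3F ∷ [])
roles (1F , 2F) (2F , 2F) = lookup (3F ∷ 1F ∷ 0F ∷ 2F ∷ 4F ∷ [])
roles (1F , 2F) (1F , 1F) = lookup (2F ∷ 1F ∷ 0F ∷ 4F ∷ 3F ∷ [])
roles (1F , 2F) (1F , 3F) = lookup (0F ∷ 1F ∷ 3F ∷ 2F ∷ 4F ∷ [])
roles (1F , 3F) (1F , 3F) = lookup (0F ∷ 1F ∷ 4F ∷ 2F ∷ 3F ∷ [])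
roles (1F , 3F) (0F , 3F) = lookup (3F ∷ 2F ∷ 0F ∷ 1F ∷ 4F ∷ [])
roles (1F , 3F) (2F , 3F) = lookup (0F ∷ 2F ∷ 4F ∷ 1F ∷ 3F ∷ [])
roles (1F , 3F) (1F , 2F) = lookup (3F ∷ 2F ∷ 0F ∷ 1F ∷ 4F ∷ [])
roles (2F , 0F) (2F , 0F) = lookup (0F ∷ 1F ∷ 3F ∷ 4F ∷ 2F ∷ [])
roles (2F , 0F) (1F , 0F) = lookup (2F ∷ 1F ∷ 0F ∷ 4F ∷ 3F ∷ [])
roles (2F , 0F) (3F , 0F) = lookup (0F ∷ 1F ∷ 3F ∷ 4F ∷ 2F ∷ [])
roles (2F , 0F) (2F , 1F) = lookup (2F ∷ 1F ∷ 0F ∷ 4F ∷ 3F ∷ [])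
roles (2F , 1F) (2F , 1F) = lookup (3F ∷ 2F ∷ 0F ∷ 1F ∷ 4F ∷ [])
roles (2F , 1F) (1F , 1F) = lookup (0F ∷ 2F ∷ 3F ∷ 1F ∷ 4F ∷ [])
roles (2F , 1F) (3F , 1F) = lookup (3F ∷ 2F ∷ 0F ∷ 1F ∷ 4F ∷ [])
roles (2F , 1F) (2F , 0F) = lookup (0F ∷ 1F ∷ 3F ∷ 2F ∷ 4F ∷ [])
roles (2F , 1F) (2F , 2F) = lookup (3F ∷ 1F ∷ 0F ∷ 2F ∷ 4F ∷ [])
roles (2F , 2F) (2F , 2F) = lookup (3F ∷ 1F ∷ 0F ∷ 2F ∷ 4F ∷ [])
roles (2F , 2F) (1F , 2F) = lookup (3F ∷ 1F ∷ 0F ∷ 2F ∷ 4F ∷ [])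
roles (2F , 2F) (3F , 2F) = lookup (3F ∷ 1F ∷ 0F ∷ 2F ∷ 4F ∷ [])
roles (2F , 2F) (2F , 1F) = lookup (2F ∷ 1F ∷ 0F ∷ 3F ∷ 4F ∷ [])
roles (2F , 2F) (2F , 3F) = lookup (2F ∷ 1F ∷ 0F ∷ 3F ∷ 4F ∷ [])
roles (2F , 3F) (2F , 3F) = lookup (3F ∷ 2F ∷ 0F ∷ 1F ∷ 4F ∷ [])
roles (2F , 3F) (1F , 3F) = lookup (3F ∷ 1F ∷ 0F ∷ 2F ∷ 4F ∷ [])
roles (2F , 3F) (3F , 3F) = lookup (3F ∷ 1F ∷ 0F ∷ 2F ∷ 4F ∷ [])
roles (2F , 3F) (2F , 2F) = lookup (3F ∷ 1F ∷ 0F ∷ 2F ∷ 4F ∷ [])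
roles (3F , 0F) (3F , 0F) = lookup (3F ∷ 1F ∷ 0F ∷ 2F ∷ 4F ∷ [])
roles (3F , 0F) (2F , 0F) = lookup (3F ∷ 1F ∷ 0F ∷ 2F ∷ 4F ∷ [])
roles (3F , 0F) (3F , 1F) = lookup (0F ∷ 1F ∷ 3F ∷ 2F ∷ 4F ∷ [])
roles (3F , 1F) (3F , 1F) = lookup (3F ∷ 2F ∷ 0F ∷ 1F ∷ 4F ∷ [])
roles (3F , 1F) (2F , 1F) = lookup (2F ∷ 1F ∷ 0F ∷ 4F ∷ 3F ∷ [])
roles (3F , 1F) (3F , 0F) = lookup (0F ∷ 2F ∷ 3F ∷ 1F ∷ 4F ∷ [])
roles (3F , 1F) (3F , 2F) = lookup (3F ∷ 1F ∷ 0F ∷ 2F ∷ 4F ∷ [])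
roles (3F , 2F) (3F , 2F) = lookup (3F ∷ 1F ∷ 0F ∷ 2F ∷ 4F ∷ [])
roles (3F , 2F) (2F , 2F) = lookup (3F ∷ 1F ∷ 0F ∷ 2F ∷ 4F ∷ [])
roles (3F , 2F) (3F , 1F) = lookup (3F ∷ 1F ∷ 0F ∷ 2F ∷ 4F ∷ [])
roles (3F , 2F) (3F , 3F) = lookup (3F ∷ 1F ∷ 0F ∷ 2F ∷ 4F ∷ [])
roles (3F , 3F) (3F , 3F) = lookup (3F ∷ 1F ∷ 0F ∷ 2F ∷ 4F ∷ [])
roles (3F , 3F) (2F , 3F) = lookup (2F ∷ 1F ∷ 0F ∷ 3F ∷ 4F ∷ [])
roles (3F , 3F) (3F , 2F) = lookup (3F ∷ 1F ∷ 0F ∷ 2F ∷ 4F ∷ [])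
roles _ _ = id

shadow-follows : ∀ u w → Step u w → Moves (shadow u) (shadow w)
shadow-follows = by-exhaustion λ u → all-×? λ w →
  step? u w →-dec all? λ i → step? (shadow u i) (shadow w i)

shadow-surrounds : ∀ v → Surrounded (shadow v) v
shadow-surrounds = by-exhaustion λ v → all-×? λ w → adj? v w →-dec any? λ i → shadow v i ≟ᵥ w

shadowing : Formation 5
shadowing = record { at = shadow ; follows = λ {u} {w} → shadow-follows u w ; surrounds = shadow-surrounds }

roles-onto : ∀ p₀ p₁ j → ∃[ i ] roles p₀ p₁ i ≡ j
roles-onto = by-exhaustion λ p₀ → all-×? λ p₁ → all? λ j → any? λ i → roles p₀ p₁ i Fin.≟ j

initial-reply : ∀ p₀ → Moves initial (reply p₀)
initial-reply = by-exhaustion λ p₀ → all? λ i → step? (initial i) (reply p₀ i)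

reply-shadow : ∀ p₀ p₁ → Step p₀ p₁ → Moves (reply p₀) (shadow p₁ ∘ roles p₀ p₁)
reply-shadow = by-exhaustion λ p₀ → all-×? λ p₁ →
  step? p₀ p₁ →-dec all? λ i → step? (reply p₀ i) (shadow p₁ (roles p₀ p₁ i))

five-bodyguards-win : BodyguardsWin 5
five-bodyguards-win =
  opening-into-formation-wins initial reply
    (λ p₀ p₁ → relabel shadowing (roles p₀ p₁) (roles-onto p₀ p₁))
    initial-reply (λ {p₀} {p₁} → reply-shadow p₀ p₁)

Inner : Set
Inner = Fin 2 × Fin 2

middle end : Fin 2 → Fin 4
middle 0F = 1F
middle 1F = 2F
end 0F = 0F
end 1F = 3F

inner : Inner → Vertex
inner (r , c) = middle r , middle c

out₁ out₂ : Inner → Vertex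
out₁ (r , c) = end r , middle c
out₂ (r , c) = middle r , end c

flip₁ flip₂ : Inner → Inner
flip₁ (r , c) = opposite r , c
flip₂ (r , c) = r , opposite c

neighbours : Inner → Vec Vertex 4
neighbours q = out₁ q ∷ out₂ q ∷ inner (flip₁ q) ∷ inner (flip₂ q) ∷ []

neighbours-unique : ∀ q → Unique (neighbours q)
neighbours-unique = by-exhaustion λ q → unique? (neighbours q)

neighbours-adjacent : ∀ q → All (Adj Grid (inner q)) (neighbours q)
neighbours-adjacent = by-exhaustion λ q → All.all? (adj? (inner q)) (neighbours q)

neighbours-complete : ∀ q w → Adj Grid (inner q) w → w ∈ neighbours q
neighbours-complete = by-exhaustion λ q → all-×? λ w → adj? (inner q) w →-dec w ∈? neighbours q

far? : ∀ x y → Dec (Far x y)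
far? x y = all-×? λ u → step? u x →-dec ¬? (step? u y)

module _ {k : ℕ} (k<5 : k < 5) {C : Conf k} (q : Inner) where
  private
    far : (x y : Inner → Vertex) {checked : True (all-×? λ q → far? (x q) (y q))} → Far (x q) (y q)
    far _ _ {checked} = toWitness checked q

    pinned : (x y z : Inner → Vertex)
             {checked : True (all-×? λ q → all-×? λ u →
                              step? u (x q) →-dec step? u (y q) →-dec step? u (z q) →-dec u ≟ᵥ z q)}
             {u : Vertex} → Step u (x q) → Step u (y q) → Step u (z q) → u ≡ z q
    pinned _ _ _ {checked} {u} = toWitness checked q u

    A A′ B B′ D : Inner → Vertex
    A  = out₂ ∘ flip₂
    A′ = out₁ ∘ flip₂
    B  = out₁ ∘ flip₁
    B′ = out₂ ∘ flip₁
    D  = inner ∘ flip₁ ∘ flip₂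

  -- The far-apart vertices out₁ q, out₂ q, A q, B q are reached by the anchors i₁, i₂, j₂, l₁,
  -- which are therefore all the bodyguards. Each other matched bodyguard is identified with an
  -- anchor by excluding the other three; then every anchor is within a step of three vertices
  -- that pin it onto a neighbour of q. (flip ∘ flip is the identity, but not definitionally.)
  threatened-thrice⇒surrounded :
    Threatens C (neighbours q) → Threatens C (neighbours (flip₂ q)) →
    Threatens C (neighbours (flip₁ q)) → Surrounded C (inner q)
  threatened-thrice⇒surrounded
    (i₁ ∷ i₂ ∷ i₃ ∷ i₄ ∷ [] ,
     (i₁≢i₂ ∷ i₁≢i₃ ∷ i₁≢i₄ ∷ []) ∷ (i₂≢i₃ ∷ i₂≢i₄ ∷ []) ∷ _ ,
     sᵢ₁ ∷ sᵢ₂ ∷ sᵢ₃ ∷ sᵢ₄ ∷ [])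
    (j₁ ∷ j₂ ∷ j₃ ∷ j₄ ∷ [] ,
     (j₁≢j₂ ∷ j₁≢j₃ ∷ j₁≢j₄ ∷ []) ∷ (j₂≢j₃ ∷ j₂≢j₄ ∷ []) ∷ (j₃≢j₄ ∷ []) ∷ [] ∷ [] ,
     sⱼ₁ ∷ sⱼ₂ ∷ sⱼ₃ ∷ sⱼ₄ ∷ [])
    (l₁ ∷ l₂ ∷ l₃ ∷ l₄ ∷ [] ,
     (l₁≢l₂ ∷ l₁≢l₃ ∷ l₁≢l₄ ∷ []) ∷ (l₂≢l₃ ∷ l₂≢l₄ ∷ []) ∷ (l₃≢l₄ ∷ []) ∷ [] ∷ [] ,
     sₗ₁ ∷ sₗ₂ ∷ sₗ₃ ∷ sₗ₄ ∷ [])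
    w adj = All.lookup occupied (neighbours-complete q w adj)
    where
    anchors : Vec (Fin k) 4
    anchors = i₁ ∷ i₂ ∷ j₂ ∷ l₁ ∷ []

    anchors-unique : Unique anchors
    anchors-unique =
      (i₁≢i₂ ∷ apart (far out₁ A) sᵢ₁ sⱼ₂ ∷ apart (far out₁ B) sᵢ₁ sₗ₁ ∷ []) ∷
      (apart (far out₂ A) sᵢ₂ sⱼ₂ ∷ apart (far out₂ B) sᵢ₂ sₗ₁ ∷ []) ∷
      (apart (far A B) sⱼ₂ sₗ₁ ∷ []) ∷ [] ∷ []

    anchor : ∀ {x y} → (x ≢ y → All (x ≢_) anchors) → x ≡ y
    anchor = unique-exhaustive (s≤s⁻¹ k<5) anchors-unique

    moved : ∀ {x y w} → x ≡ y → Step (C x) w → Step (C y) w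
    moved refl s = s

    j₃≡l₁ : j₃ ≡ l₁
    j₃≡l₁ = anchor λ j₃≢l₁ → apart (far D out₁) sⱼ₃ sᵢ₁ ∷ apart (far D out₂) sⱼ₃ sᵢ₂ ∷ ≢-sym j₂≢j₃ ∷ j₃≢l₁ ∷ []
    l₄≡j₂ : l₄ ≡ j₂
    l₄≡j₂ = anchor λ l₄≢j₂ → apart (far D out₁) sₗ₄ sᵢ₁ ∷ apart (far D out₂) sₗ₄ sᵢ₂ ∷ l₄≢j₂ ∷ ≢-sym l₁≢l₄ ∷ []
    i₃≡l₁ : i₃ ≡ l₁
    i₃≡l₁ = anchor λ i₃≢l₁ → ≢-sym i₁≢i₃ ∷ ≢-sym i₂≢i₃ ∷ apart (far (inner ∘ flip₁) A) sᵢ₃ sⱼ₂ ∷ i₃≢l₁ ∷ []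
    i₄≡j₂ : i₄ ≡ j₂
    i₄≡j₂ = anchor λ i₄≢j₂ → ≢-sym i₁≢i₄ ∷ ≢-sym i₂≢i₄ ∷ i₄≢j₂ ∷ apart (far (inner ∘ flip₂) B) sᵢ₄ sₗ₁ ∷ []
    j₁≡i₁ : j₁ ≡ i₁
    j₁≡i₁ = anchor λ j₁≢i₁ → j₁≢i₁ ∷ apart (far A′ out₂) sⱼ₁ sᵢ₂ ∷ j₁≢j₂ ∷ subst (j₁ ≢_) j₃≡l₁ j₁≢j₃ ∷ []
    j₄≡i₂ : j₄ ≡ i₂
    j₄≡i₂ = anchor λ j₄≢i₂ →
      subst (j₄ ≢_) j₁≡i₁ (≢-sym j₁≢j₄) ∷ j₄≢i₂ ∷ ≢-sym j₂≢j₄ ∷ subst (j₄ ≢_) j₃≡l₁ (≢-sym j₃≢j₄) ∷ []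
    l₂≡i₂ : l₂ ≡ i₂
    l₂≡i₂ = anchor λ l₂≢i₂ → apart (far B′ out₁) sₗ₂ sᵢ₁ ∷ l₂≢i₂ ∷ subst (l₂ ≢_) l₄≡j₂ l₂≢l₄ ∷ ≢-sym l₁≢l₂ ∷ []
    l₃≡i₁ : l₃ ≡ i₁
    l₃≡i₁ = anchor λ l₃≢i₁ →
      l₃≢i₁ ∷ subst (l₃ ≢_) l₂≡i₂ (≢-sym l₂≢l₃) ∷ subst (l₃ ≢_) l₄≡j₂ l₃≢l₄ ∷ ≢-sym l₁≢l₃ ∷ []

    occupied : All (Occupied C) (neighbours q)
    occupied =
      (i₁ , pinned A′ (inner ∘ flip₁ ∘ flip₁) out₁ (moved j₁≡i₁ sⱼ₁) (moved l₃≡i₁ sₗ₃) sᵢ₁) ∷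
      (i₂ , pinned B′ (inner ∘ flip₂ ∘ flip₂) out₂ (moved l₂≡i₂ sₗ₂) (moved j₄≡i₂ sⱼ₄) sᵢ₂) ∷
      (l₁ , pinned B D (inner ∘ flip₁) sₗ₁ (moved j₃≡l₁ sⱼ₃) (moved i₃≡l₁ sᵢ₃)) ∷
      (j₂ , pinned A D (inner ∘ flip₂) sⱼ₂ (moved l₄≡j₂ sₗ₄) (moved i₄≡j₂ sᵢ₄)) ∷ []

Safe : ∀ {k} → Conf k → Inner → Set
Safe C q = ¬ Threatens C (neighbours q)

threatened? : ∀ {k} (C : Conf k) q → Dec (Threatens C (neighbours q))
threatened? C q = threatens? step? C (neighbours q)

safe⇒unsurrounded : ∀ {k q} {C C′ : Conf k} → Safe C q → Moves C C′ → ¬ Surrounded C′ (inner q)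
safe⇒unsurrounded {q = q} safe moves surrounded =
  safe (surrounded⇒threatened moves surrounded (neighbours-unique q) (neighbours-adjacent q))

module _ {k : ℕ} (k<5 : k < 5) where
  diagonal-unsurroundable : ∀ {C : Conf k} →
                            Surrounded C (inner (0F , 0F)) → Surrounded C (inner (1F , 1F)) → ⊥
  diagonal-unsurroundable {C} s₀₀ s₁₁ = ≤⇒≯ (s≤s⁻¹ k<5) (occupied-unique⇒≤ distinct occupied)
    where
    distinct : Unique (out₁ (1F , 1F) ∷ neighbours (0F , 0F))
    distinct = from-yes (unique? (out₁ (1F , 1F) ∷ neighbours (0F , 0F)))

    occupied : All (Occupied C) (out₁ (1F , 1F) ∷ neighbours (0F , 0F))
    occupied =
      s₁₁ _ (All.head (neighbours-adjacent (1F , 1F))) ∷ All.map (s₀₀ _) (neighbours-adjacent (0F , 0F))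

  safe-start : ∀ C → Σ Inner (Safe C)
  safe-start C
    with threatened? C (0F , 0F) | threatened? C (0F , 1F) | threatened? C (1F , 0F) | threatened? C (1F , 1F)
  ... | no safe | _ | _ | _ = (0F , 0F) , safe
  ... | yes _ | no safe | _ | _ = (0F , 1F) , safe
  ... | yes _ | yes _ | no safe | _ = (1F , 0F) , safe
  ... | yes _ | yes _ | yes _ | no safe = (1F , 1F) , safe
  ... | yes t₀₀ | yes t₀₁ | yes t₁₀ | yes t₁₁ =
    ⊥-elim (diagonal-unsurroundable (threatened-thrice⇒surrounded k<5 (0F , 0F) t₀₀ t₀₁ t₁₀)
                                     (threatened-thrice⇒surrounded k<5 (1F , 1F) t₁₁ t₁₀ t₀₁))

  flee : ∀ C q → Σ[ q′ ∈ Inner ] Step (inner q) (inner q′) × (¬ Surrounded C (inner q) → Safe C q′)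
  flee C q with threatened? C q | threatened? C (flip₂ q) | threatened? C (flip₁ q) | neighbours-adjacent q
  ... | no safe | _ | _ | _ = q , inj₁ refl , λ _ → safe
  ... | yes _ | no safe | _ | _ ∷ _ ∷ _ ∷ adj ∷ [] = flip₂ q , inj₂ adj , λ _ → safe
  ... | yes _ | yes _ | no safe | _ ∷ _ ∷ adj ∷ _ ∷ [] = flip₁ q , inj₂ adj , λ _ → safe
  ... | yes t | yes t₂ | yes t₁ | _ =
    q , inj₁ refl , λ unsurrounded → ⊥-elim (unsurrounded (threatened-thrice⇒surrounded k<5 q t t₂ t₁))

  fewer-than-five-lose : ¬ BodyguardsWin k
  fewer-than-five-lose = president-escapes inner Safe safe-start flee safe⇒unsurrounded

lemma4p4 : BodyguardNumberIs (Path 4 □ Path 4) 5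
lemma4p4 = five-bodyguards-win , λ _ → fewer-than-five-lose
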